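{- Let $G$ and $H$ be graphs and suppose there exist $v\in V(G)$ and $u\in V(H)$ such that (1) $\operatorname{CS}(G-v,x)\preceq \operatorname{CS}(H-u,x)$, (2) $\operatorname{CS}(G/v,x)\preceq \operatorname{CS}(H/u,x)$, and (3) $\operatorname{CS}(H-N[u],x)\preceq \operatorname{CS}(G-N[v],x)$. Then $\operatorname{CS}(G,x)\preceq \operatorname{CS}(H,x)$.
   Context: All graphs are finite, simple and undirected. $G-v$ is obtained by deleting $v$ and its incident edges; $N[v]$ is the closed neighbourhood of $v$, and $G-N[v]$ is obtained by deleting all vertices of $N[v]$; $G/v$ is obtained from $G-v$ by adding all missing edges between pairs of vertices of $N[v]\setminus\{v\}$. A connected set is a vertex subset inducing a connected subgraph; $S_k(G)$ is the number of connected sets of size $k$ and $\operatorname{CS}(G,x)=\sum_{k\ge1}S_k(G)x^k$. For polynomials $A(x)=\sum_{k=0}^n a_kx^k$, $B(x)=\sum_{k=0}^m b_kx^k$, write $B(x)\preceq A(x)$ if $m\le n$ and $b_k\le a_k$ for all $k$. -}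

module Defs where

open import Data.Bool using (Bool; true; false; _∧_; _∨_; not; if_then_else_)
open import Data.Nat using (ℕ; zero; suc; _≤_; _≡ᵇ_)
open import Data.Fin using (Fin; toℕ)
open import Data.Vec using (Vec; []; _∷_; lookup)
open import Data.List using (List; []; _∷_; map; _++_; length; filterᵇ; allFin)
open import Data.Bool.ListAction using () renaming (any to anyL; all to allL)
open import Relation.Binary.PropositionalEquality using (_≡_)

record Graph (n : ℕ) : Set where
  field
    adj    : Fin n → Fin n → Bool
    sym    : ∀ a b → adj a b ≡ adj b a
    irrefl : ∀ a → adj a a ≡ false
open Graph public

VSet : ℕ → Set
VSet n = Vec Bool n

_∈?_ : {n : ℕ} → Fin n → VSet n → Bool
a ∈? T = lookup T a

_==F_ : {n : ℕ} → Fin n → Fin n → Bool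
a ==F b = toℕ a ≡ᵇ toℕ b

allSubsets : (n : ℕ) → List (VSet n)
allSubsets zero    = [] ∷ []
allSubsets (suc n) = map (false ∷_) (allSubsets n) ++ map (true ∷_) (allSubsets n)

size : {n : ℕ} → VSet n → ℕ
size []          = 0
size (false ∷ T) = size T
size (true ∷ T)  = suc (size T)

_⊆?_ : {n : ℕ} → VSet n → VSet n → Bool
_⊆?_ {n} T S = allL (λ a → not (a ∈? T) ∨ (a ∈? S)) (allFin n)

-- Adjacency relations (not necessarily required symmetric here; used for
-- both G and G/v).
Adj : ℕ → Set
Adj n = Fin n → Fin n → Bool

-- walkWithin E T k a b : there is a walk from a to b of length ≤ k in E
-- all of whose vertices lie in T (a itself is assumed to lie in T).
walkWithin : {n : ℕ} → Adj n → VSet n → ℕ → Fin n → Fin n → Bool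
walkWithin {n} E T zero    a b = a ==F b
walkWithin {n} E T (suc k) a b =
  (a ==F b) ∨ anyL (λ c → (c ∈? T) ∧ E a c ∧ walkWithin E T k c b) (allFin n)

-- Walks of length
-- ≤ n suffice (a shortest walk is a path, of length < n).
isConnectedSet : {n : ℕ} → Adj n → VSet n → Bool
isConnectedSet {n} E T =
  anyL (λ a → a ∈? T) (allFin n) ∧
  allL (λ a → allL (λ b → not (a ∈? T) ∨ not (b ∈? T) ∨ walkWithin E T n a b)
                   (allFin n)) (allFin n)

Sk : {n : ℕ} → Adj n → VSet n → ℕ → ℕ
Sk {n} E S k = length (filterᵇ (λ T → (T ⊆? S) ∧ isConnectedSet E T ∧ (size T ≡ᵇ k))
                               (allSubsets n))

-- A graph "given by adjacency E restricted to vertex set S"; the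
-- coefficient sequence of its connected set polynomial CS(·,x) is
-- k ↦ Sk E S k (k ≥ 1; Sk E S 0 = 0 since connected sets are nonempty).
record Induced (n : ℕ) : Set where
  constructor ⟨_,_⟩
  field
    edges : Adj n
    verts : VSet n

CScoeff : {n : ℕ} → Induced n → ℕ → ℕ
CScoeff ⟨ E , S ⟩ k = Sk E S k

fullSet : (n : ℕ) → VSet n
fullSet n = Data.Vec.replicate n true

whole : {n : ℕ} → Graph n → Induced n
whole {n} G = ⟨ adj G , fullSet n ⟩

del : {n : ℕ} → Graph n → Fin n → Induced n
del {n} G v = ⟨ adj G , Data.Vec.tabulate (λ a → not (a ==F v)) ⟩

delN : {n : ℕ} → Graph n → Fin n → Induced n
delN {n} G v = ⟨ adj G , Data.Vec.tabulate (λ a → not (a ==F v) ∧ not (adj G v a)) ⟩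

contr : {n : ℕ} → Graph n → Fin n → Induced n
contr {n} G v =
  ⟨ (λ a b → adj G a b ∨ (not (a ==F b) ∧ adj G v a ∧ adj G v b))
  , Data.Vec.tabulate (λ a → not (a ==F v)) ⟩

_⪯_ : {m n : ℕ} → Induced m → Induced n → Set
B ⪯ A = ∀ k → CScoeff B k ≤ CScoeff A k

-- Fix v and a vertex set X of G not containing v. If X contains a neighbour of v, then
-- X ∪ {v} is connected in G exactly when X is connected in G/v: a walk through v is
-- shortcut by an edge of the clique on N(v), and each such edge is a detour through v.
-- If X is nonempty but has no neighbour of v, then X ∪ {v} is not connected, and X is
-- connected in G/v exactly when it is a connected set of G − N[v]; for X = ∅ the set {v}
-- is connected. Sorting the connected sets of G of size k + 1 by whether they contain v:
--   S_{k+1}(G) + S_k(G − N[v]) = S_{k+1}(G − v) + S_k(G/v) + [k = 0].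
-- For G and H this identity and the hypotheses give
--   S_{k+1}(G) + S_k(G − N[v]) ≤ S_{k+1}(H) + S_k(H − N[u]) ≤ S_{k+1}(H) + S_k(G − N[v]).

module Submission where

open import Defs hiding (sym)
open import Data.Bool using (Bool; true; false; T; not; _∧_; _∨_; if_then_else_)
open import Data.Bool.Properties using (T?; T-∧; T-∨; T-≡; ∧-identityʳ; ∧-zeroʳ; ∧-assoc)
open import Data.Bool.ListAction using () renaming (any to anyL; all to allL)
open import Data.Empty using (⊥; ⊥-elim)
open import Data.Fin using (Fin; toℕ; zero; suc; _≟_)
open import Data.Fin.Properties using (toℕ-injective; any?)
open import Data.Fin.Subset as Subset using (Subset; ∣_∣; _⊆_)
open import Data.Fin.Subset.Properties
  using (_⊂?_; ∣p∣≤n; p⊂q⇒∣p∣<∣q∣; ∣p∣≡n⇒p≡⊤; ⊆⊤; ⊆-refl; ⊆-trans)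
  renaming (_∈?_ to _∈ₛ?_)
open import Data.List using (List; []; _∷_; allFin; map; _++_; length; filterᵇ)
open import Data.List.Properties using (map-++; map-∘)
open import Data.List.Membership.Propositional using (lose)
open import Data.List.Membership.Propositional.Properties using (∈-allFin)
open import Data.List.Relation.Unary.All as All using (All)
open import Data.List.Relation.Unary.All.Properties using (all⁺; all⁻)
open import Data.List.Relation.Unary.Any using (satisfied)
open import Data.List.Relation.Unary.Any.Properties using (any⁺; any⁻)
open import Data.Nat using (ℕ; zero; suc; _+_; _≡ᵇ_; _≤_; z≤n; s≤s)
open import Data.Nat.ListAction using (sum)
open import Data.Nat.ListAction.Properties using (sum-++)
open import Data.Nat.Properties
  using (≡ᵇ⇒≡; ≡⇒≡ᵇ; ≤-antisym; ≤-trans; m≤n⇒m≤1+n; n≤1+n; +-identityʳ; +-assoc;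
         +-cancelʳ-≤; +-mono-≤; +-monoˡ-≤; +-monoʳ-≤; +-commutativeSemigroup; module ≤-Reasoning)
open import Algebra.Properties.CommutativeSemigroup +-commutativeSemigroup using (interchange)
open import Data.Product using (_×_; _,_; ∃; proj₁; proj₂)
open import Data.Sum using (_⊎_; inj₁; inj₂)
open import Data.Unit using (tt)
open import Data.Vec using ([]; _∷_; tabulate; lookup; _[_]≔_)
open import Data.Vec.Properties
  using (lookup-replicate; lookup∘update; lookup∘update′; lookup∘tabulate;
         []=⇒lookup; lookup⇒[]=)
open import Function using (_∘_)
open import Function.Bundles using (Equivalence)
open import Level using (0ℓ)
open import Relation.Binary using (Rel; _⇒_; Sym)
open import Relation.Binary.Construct.Closure.ReflexiveTransitive
  using (Star; ε; _◅_; _◅◅_; _⋆; reverse)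
open import Relation.Binary.PropositionalEquality
  using (_≡_; _≢_; refl; sym; trans; cong; cong₂; subst; module ≡-Reasoning)
open import Relation.Nullary using (¬_; yes; no; contradiction)

open Equivalence using (to; from)

𝟙 : Bool → ℕ
𝟙 true  = 1
𝟙 false = 0

T-ext : ∀ {a b} → (T a → T b) → (T b → T a) → a ≡ b
T-ext {false} {false} _ _ = refl
T-ext {false} {true}  _ g = ⊥-elim (g tt)
T-ext {true}  {false} f _ = ⊥-elim (f tt)
T-ext {true}  {true}  _ _ = refl

T-not⇒¬T : ∀ {a} → T (not a) → ¬ T a
T-not⇒¬T {false} _ ()

¬T⇒T-not : ∀ {a} → ¬ T a → T (not a)
¬T⇒T-not {false} _  = tt
¬T⇒T-not {true}  ¬a = ¬a tt

¬T⇒≡false : ∀ {a} → ¬ T a → a ≡ false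
¬T⇒≡false {false} _  = refl
¬T⇒≡false {true}  ¬a = ⊥-elim (¬a tt)

𝟙+𝟙-cong : ∀ {a b c d a′ b′ c′ d′} → a ≡ a′ → b ≡ b′ → c ≡ c′ → d ≡ d′ →
           𝟙 a′ + 𝟙 b′ ≡ 𝟙 c′ + 𝟙 d′ → 𝟙 a + 𝟙 b ≡ 𝟙 c + 𝟙 d
𝟙+𝟙-cong refl refl refl refl eq = eq

𝟙-restrict : ∀ a b c d s → 𝟙 a + 𝟙 b ≡ 𝟙 c + 𝟙 d →
             𝟙 (a ∧ s) + 𝟙 (b ∧ s) ≡ 𝟙 (c ∧ s) + 𝟙 (d ∧ s)
𝟙-restrict a b c d true eq
  rewrite ∧-identityʳ a | ∧-identityʳ b | ∧-identityʳ c | ∧-identityʳ d = eq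
𝟙-restrict a b c d false _
  rewrite ∧-zeroʳ a | ∧-zeroʳ b | ∧-zeroʳ c | ∧-zeroʳ d = refl

anyFin⁺ : ∀ {n} (p : Fin n → Bool) a → T (p a) → T (anyL p (allFin n))
anyFin⁺ {n} p a pa = any⁺ {xs = allFin n} p (lose (∈-allFin a) pa)

anyFin⁻ : ∀ {n} (p : Fin n → Bool) → T (anyL p (allFin n)) → ∃ λ a → T (p a)
anyFin⁻ {n} p h = satisfied (any⁻ p (allFin n) h)

allFin⁺ : ∀ {n} (p : Fin n → Bool) → (∀ a → T (p a)) → T (allL p (allFin n))
allFin⁺ {n} p h = all⁻ p {xs = allFin n} (All.tabulate (λ {a} _ → h a))

allFin⁻ : ∀ {n} (p : Fin n → Bool) → T (allL p (allFin n)) → ∀ a → T (p a)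
allFin⁻ p h a = All.lookup (all⁺ p _ h) (∈-allFin a)

T-implies⁺ : ∀ {a b} → (T a → T b) → T (not a ∨ b)
T-implies⁺ {false} _ = tt
T-implies⁺ {true}  f = f tt

T-implies⁻ : ∀ {a b} → T (not a ∨ b) → T a → T b
T-implies⁻ {true} h _ = h

==F⇒≡ : ∀ {n} {a b : Fin n} → T (a ==F b) → a ≡ b
==F⇒≡ {a = a} {b} h = toℕ-injective (≡ᵇ⇒≡ (toℕ a) (toℕ b) h)

≡⇒==F : ∀ {n} {a b : Fin n} → a ≡ b → T (a ==F b)
≡⇒==F {a = a} refl = ≡⇒≡ᵇ (toℕ a) (toℕ a) refl

≢⇒not==F : ∀ {n} {a b : Fin n} → a ≢ b → T (not (a ==F b))
≢⇒not==F a≢b = ¬T⇒T-not (a≢b ∘ ==F⇒≡)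

∈-tabulate⁺ : ∀ {n} {f : Fin n → Bool} {a} → T (f a) → a Subset.∈ tabulate f
∈-tabulate⁺ {f = f} {a} fa =
  lookup⇒[]= a (tabulate f) (trans (lookup∘tabulate f a) (T-≡ .to fa))

∈-tabulate⁻ : ∀ {n} {f : Fin n → Bool} {a} → a Subset.∈ tabulate f → T (f a)
∈-tabulate⁻ {f = f} {a} a∈ =
  T-≡ .from (trans (sym (lookup∘tabulate f a)) ([]=⇒lookup a∈))

-- Monotone chains of subsets of Fin n

module _ {n : ℕ} (R : ℕ → Subset n)
         (R-base : R 0 ⊆ R 1)
         (R-step : ∀ {i j} → R i ⊆ R j → R (suc i) ⊆ R (suc j)) where

  private
    chain-increasing : ∀ i → R i ⊆ R (suc i)
    chain-increasing zero    = R-base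
    chain-increasing (suc i) = R-step (chain-increasing i)

    base-below : ∀ j → R 0 ⊆ R j
    base-below zero    = ⊆-refl
    base-below (suc j) = ⊆-trans (base-below j) (chain-increasing j)

    chain-mono : ∀ {i j} → i ≤ j → R i ⊆ R j
    chain-mono {j = j} z≤n = base-below j
    chain-mono (s≤s i≤j)   = R-step (chain-mono i≤j)

    stable-absorbs : ∀ {j} → R (suc j) ⊆ R j → ∀ k → R k ⊆ R j
    stable-absorbs s zero    = base-below _
    stable-absorbs s (suc k) = ⊆-trans (R-step (stable-absorbs s k)) s

    stabilises-or-grows : ∀ k → (∃ λ j → j ≤ k × R (suc j) ⊆ R j) ⊎ k ≤ ∣ R k ∣
    stabilises-or-grows zero = inj₂ z≤n
    stabilises-or-grows (suc k) with stabilises-or-grows k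
    ... | inj₁ (j , j≤k , s) = inj₁ (j , m≤n⇒m≤1+n j≤k , s)
    ... | inj₂ k≤∣Rk∣ with R k ⊂? R (suc k)
    ...   | yes Rk⊂ = inj₂ (≤-trans (s≤s k≤∣Rk∣) (p⊂q⇒∣p∣<∣q∣ Rk⊂))
    ...   | no ¬Rk⊂ = inj₁ (k , n≤1+n k , shrink)
      where
      shrink : R (suc k) ⊆ R k
      shrink {x} x∈ with x ∈ₛ? R k
      ... | yes x∈Rk = x∈Rk
      ... | no  x∉Rk = contradiction ((λ {y} → chain-increasing k {y}) , x , x∈ , x∉Rk) ¬Rk⊂

  -- Either the chain stops growing at some j ≤ n and is constant from then on,
  -- or it grows at every step and is the full set at step n.
  chain-stabilises : ∀ k → R k ⊆ R n
  chain-stabilises k with stabilises-or-grows n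
  ... | inj₁ (j , j≤n , s) = ⊆-trans (stable-absorbs s k) (chain-mono j≤n)
  ... | inj₂ n≤∣Rn∣ =
    subst (R k ⊆_) (sym (∣p∣≡n⇒p≡⊤ (≤-antisym (∣p∣≤n (R n)) n≤∣Rn∣))) ⊆⊤

-- Walks and connected sets

InducedEdge : ∀ {n} → Adj n → VSet n → Rel (Fin n) 0ℓ
InducedEdge E X a c = T (a ∈? X) × T (c ∈? X) × T (E a c)

Walk : ∀ {n} → Adj n → VSet n → Rel (Fin n) 0ℓ
Walk E X = Star (InducedEdge E X)

module _ {n : ℕ} {E : Adj n} {X : VSet n} where

  walkWithin-suc⁺ : ∀ k {a b} →
                    a ≡ b ⊎ (∃ λ c → T (c ∈? X) × T (E a c) × T (walkWithin E X k c b)) →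
                    T (walkWithin E X (suc k) a b)
  walkWithin-suc⁺ k (inj₁ a≡b) = T-∨ .from (inj₁ (≡⇒==F a≡b))
  walkWithin-suc⁺ k {a} {b} (inj₂ (c , c∈X , ac , w)) =
    T-∨ {a ==F b} .from (inj₂ (anyFin⁺ _ c (T-∧ .from (c∈X , T-∧ .from (ac , w)))))

  walkWithin-suc⁻ : ∀ k {a b} → T (walkWithin E X (suc k) a b) →
                    a ≡ b ⊎ (∃ λ c → T (c ∈? X) × T (E a c) × T (walkWithin E X k c b))
  walkWithin-suc⁻ k {a} {b} w with T-∨ {a ==F b} .to w
  ... | inj₁ a=b = inj₁ (==F⇒≡ a=b)
  ... | inj₂ step with anyFin⁻ _ step
  ...   | c , h with T-∧ .to h
  ...     | c∈X , h′ with T-∧ .to h′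
  ...       | ac , w′ = inj₂ (c , c∈X , ac , w′)

  walkWithin-sound : ∀ k {a b} → T (a ∈? X) → T (walkWithin E X k a b) → Walk E X a b
  walkWithin-sound zero {a} {b} _ w with ==F⇒≡ {a = a} {b} w
  ... | refl = ε
  walkWithin-sound (suc k) a∈X w with walkWithin-suc⁻ k w
  ... | inj₁ refl = ε
  ... | inj₂ (c , c∈X , ac , w′) = (a∈X , c∈X , ac) ◅ walkWithin-sound k c∈X w′

  private
    walkWithin-exists : ∀ {a b} → Walk E X a b → ∃ λ k → T (walkWithin E X k a b)
    walkWithin-exists {a} ε = 0 , ≡⇒==F {a = a} refl
    walkWithin-exists ((_ , c∈X , ac) ◅ w) with walkWithin-exists w
    ... | k , w′ = suc k , walkWithin-suc⁺ k (inj₂ (_ , c∈X , ac , w′))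

    walkWithin-shorten : ∀ k {a b} → T (walkWithin E X k a b) → T (walkWithin E X n a b)
    -- The vertices reaching b within k steps form a chain of subsets R k with
    -- R (k + 1) determined monotonically by R k, so R k ⊆ R n.
    walkWithin-shorten k {a} {b} w =
      ∈-tabulate⁻ {f = reach n}
        (chain-stabilises R R-base (λ {i} {j} → R-step {i} {j}) k (∈-tabulate⁺ {f = reach k} w))
      where
      reach : ℕ → Fin n → Bool
      reach k x = walkWithin E X k x b

      R : ℕ → Subset n
      R k = tabulate (reach k)

      R-base : R 0 ⊆ R 1
      R-base x∈ =
        ∈-tabulate⁺ {f = reach 1}
          (walkWithin-suc⁺ 0 (inj₁ (==F⇒≡ (∈-tabulate⁻ {f = reach 0} x∈))))

      R-step : ∀ {i j} → R i ⊆ R j → R (suc i) ⊆ R (suc j)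
      R-step {i} {j} Ri⊆Rj x∈ with walkWithin-suc⁻ i (∈-tabulate⁻ {f = reach (suc i)} x∈)
      ... | inj₁ x≡b = ∈-tabulate⁺ {f = reach (suc j)} (walkWithin-suc⁺ j (inj₁ x≡b))
      ... | inj₂ (c , c∈X , xc , w′) =
        ∈-tabulate⁺ {f = reach (suc j)} (walkWithin-suc⁺ j (inj₂ (c , c∈X , xc ,
          ∈-tabulate⁻ {f = reach j} (Ri⊆Rj (∈-tabulate⁺ {f = reach i} w′)))))

  walkWithin-complete : ∀ {a b} → Walk E X a b → T (walkWithin E X n a b)
  walkWithin-complete w = let k , w′ = walkWithin-exists w in walkWithin-shorten k w′

record Connected {n : ℕ} (E : Adj n) (X : VSet n) : Set where
  field
    member : ∃ λ a → T (a ∈? X)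
    walk   : ∀ {a b} → T (a ∈? X) → T (b ∈? X) → Walk E X a b
open Connected

module _ {n : ℕ} {E : Adj n} {X : VSet n} where

  private
    linked : Fin n → Fin n → Bool
    linked a b = not (a ∈? X) ∨ not (b ∈? X) ∨ walkWithin E X n a b

    linked-from : Fin n → Bool
    linked-from a = allL (linked a) (allFin n)

  isConnectedSet⁺ : Connected E X → T (isConnectedSet E X)
  isConnectedSet⁺ c with member c
  ... | a , a∈X = T-∧ .from
    ( anyFin⁺ (_∈? X) a a∈X
    , allFin⁺ linked-from λ x → allFin⁺ (linked x) λ y →
        T-implies⁺ λ x∈X → T-implies⁺ λ y∈X →
          walkWithin-complete {E = E} (walk c x∈X y∈X) )

  isConnectedSet⁻ : T (isConnectedSet E X) → Connected E X
  isConnectedSet⁻ h with T-∧ .to h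
  ... | some , all-linked = record
    { member = anyFin⁻ (_∈? X) some
    ; walk   = λ {a} {b} a∈X b∈X → walkWithin-sound n a∈X
        (T-implies⁻ (T-implies⁻ (allFin⁻ (linked a) (allFin⁻ linked-from all-linked a) b) a∈X)
                    b∈X)
    }

Connected-transfer : ∀ {n} {E E′ : Adj n} {X : VSet n} →
                     InducedEdge E X ⇒ Walk E′ X → Connected E X → Connected E′ X
member (Connected-transfer f c) = member c
walk   (Connected-transfer f c) a∈X b∈X = (f ⋆) (walk c a∈X b∈X)

module _ {n : ℕ} (E : Adj n) (X : VSet n) where

  isConnectedSet-true : Connected E X → isConnectedSet E X ≡ true
  isConnectedSet-true c = T-≡ .to (isConnectedSet⁺ c)

  isConnectedSet-false : ¬ Connected E X → isConnectedSet E X ≡ false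
  isConnectedSet-false ¬c = ¬T⇒≡false (λ h → ¬c (isConnectedSet⁻ h))

  isConnectedSet-≡ : ∀ (E′ : Adj n) (X′ : VSet n) →
                     (Connected E X → Connected E′ X′) →
                     (Connected E′ X′ → Connected E X) →
                     isConnectedSet E X ≡ isConnectedSet E′ X′
  isConnectedSet-≡ E′ X′ f g = T-ext (λ h → isConnectedSet⁺ (f (isConnectedSet⁻ h)))
                                     (λ h → isConnectedSet⁺ (g (isConnectedSet⁻ h)))

-- Vertex subsets and sums over all of them

module _ {n : ℕ} (X S : VSet n) where

  ⊆?⁺ : (∀ {a} → T (a ∈? X) → T (a ∈? S)) → T (X ⊆? S)
  ⊆?⁺ h = allFin⁺ (λ a → not (a ∈? X) ∨ (a ∈? S)) λ a → T-implies⁺ h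

  ⊆?⁻ : T (X ⊆? S) → ∀ {a} → T (a ∈? X) → T (a ∈? S)
  ⊆?⁻ h {a} = T-implies⁻ (allFin⁻ (λ a → not (a ∈? X) ∨ (a ∈? S)) h a)

  ⊆?-false : ∀ {a} → T (a ∈? X) → ¬ T (a ∈? S) → (X ⊆? S) ≡ false
  ⊆?-false a∈X a∉S = ¬T⇒≡false λ X⊆S → a∉S (⊆?⁻ X⊆S a∈X)

⊆?-fullSet : ∀ {n} (X : VSet n) → T (X ⊆? fullSet n)
⊆?-fullSet {n} X = ⊆?⁺ X (fullSet n) λ {a} _ → subst T (sym (lookup-replicate a true)) tt

size-insert : ∀ {n} (X : VSet n) v → lookup X v ≡ false →
              size (X [ v ]≔ true) ≡ suc (size X)
size-insert (false ∷ X) zero    _ = refl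
size-insert (false ∷ X) (suc v) e = size-insert X v e
size-insert (true ∷ X)  (suc v) e = cong suc (size-insert X v e)

size-member : ∀ {n} (X : VSet n) {a} → T (a ∈? X) → (size X ≡ᵇ 0) ≡ false
size-member (true ∷ X)  {zero}  _ = refl
size-member (true ∷ X)  {suc a} _ = refl
size-member (false ∷ X) {suc a} h = size-member X h

size-empty : ∀ {n} (X : VSet n) → (∀ a → ¬ T (a ∈? X)) → (size X ≡ᵇ 0) ≡ true
size-empty []          _     = refl
size-empty (false ∷ X) empty = size-empty X (λ a → empty (suc a))
size-empty (true ∷ X)  empty = ⊥-elim (empty zero tt)

length-filterᵇ : ∀ {A : Set} (p : A → Bool) xs →
                 length (filterᵇ p xs) ≡ sum (map (𝟙 ∘ p) xs)
length-filterᵇ p []       = refl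
length-filterᵇ p (x ∷ xs) with p x
... | true  = cong suc (length-filterᵇ p xs)
... | false = length-filterᵇ p xs

sumSubsets : ∀ {n} → (VSet n → ℕ) → ℕ
sumSubsets {zero}  f = f []
sumSubsets {suc n} f = sumSubsets (λ X → f (false ∷ X)) + sumSubsets (λ X → f (true ∷ X))

sum-map-allSubsets : ∀ {n} (f : VSet n → ℕ) → sum (map f (allSubsets n)) ≡ sumSubsets f
sum-map-allSubsets {zero}  f = +-identityʳ (f [])
sum-map-allSubsets {suc n} f = begin
  sum (map f (map (false ∷_) A ++ map (true ∷_) A))
    ≡⟨ cong sum (map-++ f (map (false ∷_) A) (map (true ∷_) A)) ⟩
  sum (map f (map (false ∷_) A) ++ map f (map (true ∷_) A))
    ≡⟨ sum-++ (map f (map (false ∷_) A)) _ ⟩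
  sum (map f (map (false ∷_) A)) + sum (map f (map (true ∷_) A))
    ≡⟨ sym (cong₂ _+_ (cong sum (map-∘ A)) (cong sum (map-∘ A))) ⟩
  sum (map (λ X → f (false ∷ X)) A) + sum (map (λ X → f (true ∷ X)) A)
    ≡⟨ cong₂ _+_ (sum-map-allSubsets {n} _) (sum-map-allSubsets {n} _) ⟩
  sumSubsets f ∎
  where
  open ≡-Reasoning
  A : List (VSet n)
  A = allSubsets n

sumSubsets-+ : ∀ {n} (f g : VSet n → ℕ) →
               sumSubsets (λ X → f X + g X) ≡ sumSubsets f + sumSubsets g
sumSubsets-+ {zero}  f g = refl
sumSubsets-+ {suc n} f g =
  trans (cong₂ _+_ (sumSubsets-+ (λ X → f (false ∷ X)) (λ X → g (false ∷ X)))
                   (sumSubsets-+ (λ X → f (true ∷ X)) (λ X → g (true ∷ X))))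
        (interchange (sumSubsets (λ X → f (false ∷ X))) _ _ _)

sumSubsets-cong : ∀ {n} {f g : VSet n → ℕ} →
                  (∀ X → f X ≡ g X) → sumSubsets f ≡ sumSubsets g
sumSubsets-cong {zero}  f≗g = f≗g []
sumSubsets-cong {suc n} f≗g =
  cong₂ _+_ (sumSubsets-cong (λ X → f≗g (false ∷ X))) (sumSubsets-cong (λ X → f≗g (true ∷ X)))

sumSubsets-zero : ∀ n → sumSubsets {n} (λ _ → 0) ≡ 0
sumSubsets-zero zero    = refl
sumSubsets-zero (suc n) = cong₂ _+_ (sumSubsets-zero n) (sumSubsets-zero n)

sumSubsets-split : ∀ {n} (v : Fin n) (f : VSet n → ℕ) →
  sumSubsets f ≡ sumSubsets (λ X → if lookup X v then 0 else f X + f (X [ v ]≔ true))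
sumSubsets-split {suc n} zero f = begin
  sumSubsets (λ X → f (false ∷ X)) + sumSubsets (λ X → f (true ∷ X))
    ≡⟨ sym (sumSubsets-+ (λ X → f (false ∷ X)) (λ X → f (true ∷ X))) ⟩
  sumSubsets (λ X → f (false ∷ X) + f (true ∷ X))
    ≡⟨ +-identityʳ (g) ⟨
  g + 0
    ≡⟨ cong (g +_) (sumSubsets-zero n) ⟨
  g + sumSubsets {n} (λ _ → 0) ∎
  where
  open ≡-Reasoning
  g : ℕ
  g = sumSubsets (λ X → f (false ∷ X) + f (true ∷ X))
sumSubsets-split {suc n} (suc v) f =
  cong₂ _+_ (sumSubsets-split v (λ X → f (false ∷ X))) (sumSubsets-split v (λ X → f (true ∷ X)))

sumSubsets-empty : ∀ n k →
                   sumSubsets {n} (λ X → 𝟙 ((size X ≡ᵇ 0) ∧ (size X ≡ᵇ k))) ≡ 𝟙 (0 ≡ᵇ k)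
sumSubsets-empty zero    k = refl
sumSubsets-empty (suc n) k =
  trans (cong₂ _+_ (sumSubsets-empty n k) (sumSubsets-zero n)) (+-identityʳ _)

isCounted : ∀ {n} → Adj n → VSet n → ℕ → VSet n → Bool
isCounted E S k X = (X ⊆? S) ∧ isConnectedSet E X ∧ (size X ≡ᵇ k)

Sk-as-sumSubsets : ∀ {n} (E : Adj n) S k → Sk E S k ≡ sumSubsets (𝟙 ∘ isCounted E S k)
Sk-as-sumSubsets {n} E S k =
  trans (length-filterᵇ (isCounted E S k) (allSubsets n)) (sum-map-allSubsets (𝟙 ∘ isCounted E S k))

module _ {n : ℕ} (E : Adj n) (S X : VSet n) (k : ℕ) where

  isCounted-⊆ : T (X ⊆? S) → isCounted E S k X ≡ isConnectedSet E X ∧ (size X ≡ᵇ k)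
  isCounted-⊆ X⊆S = cong (_∧ (isConnectedSet E X ∧ (size X ≡ᵇ k))) (T-≡ .to X⊆S)

  isCounted-⊈ : ∀ {a} → T (a ∈? X) → ¬ T (a ∈? S) → isCounted E S k X ≡ false
  isCounted-⊈ a∈X a∉S =
    cong (_∧ (isConnectedSet E X ∧ (size X ≡ᵇ k))) (⊆?-false X S a∈X a∉S)

Sk-zero : ∀ {n} (E : Adj n) (S : VSet n) → Sk E S 0 ≡ 0
Sk-zero {n} E S = trans (Sk-as-sumSubsets E S 0) (trans (sumSubsets-cong none) (sumSubsets-zero n))
  where
  connected-nonempty : ∀ X → isConnectedSet E X ∧ (size X ≡ᵇ 0) ≡ false
  connected-nonempty X with isConnectedSet E X in conn
  ... | false = refl
  ... | true  = size-member X (proj₂ (member (isConnectedSet⁻ {E = E} {X} (T-≡ .from conn))))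

  none : ∀ X → 𝟙 (isCounted E S 0 X) ≡ 0
  none X = cong 𝟙 (trans (cong (X ⊆? S ∧_) (connected-nonempty X)) (∧-zeroʳ (X ⊆? S)))

-- Deleting, reinserting and contracting a vertex

module _ {n : ℕ} (G : Graph n) (v : Fin n) where

  private
    E E/v : Adj n
    E   = adj G
    E/v = Induced.edges (contr G v)

    V∖v V∖N[v] : VSet n
    V∖v = Induced.verts (del G v)
    V∖N[v] = Induced.verts (delN G v)

    adj-sym : ∀ {a b} → T (E a b) → T (E b a)
    adj-sym {a} {b} = subst T (Graph.sym G a b)

    adj-irrefl : ∀ {a} → ¬ T (E a a)
    adj-irrefl {a} = subst T (Graph.irrefl G a)

    v∉V∖v : ¬ T (v ∈? V∖v)
    v∉V∖v v∈ = T-not⇒¬T (subst T (lookup∘tabulate _ v) v∈) (≡⇒==F {a = v} refl)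

    ∈V∖v : ∀ {a} → a ≢ v → T (a ∈? V∖v)
    ∈V∖v {a} a≢v = subst T (sym (lookup∘tabulate _ a)) (≢⇒not==F a≢v)

    V∖N[v]-spec : ∀ {a} → T (a ∈? V∖N[v]) → T (not (a ==F v)) × T (not (E v a))
    V∖N[v]-spec {a} a∈ = T-∧ .to (subst T (lookup∘tabulate _ a) a∈)

    ∈V∖N[v] : ∀ {a} → a ≢ v → ¬ T (E v a) → T (a ∈? V∖N[v])
    ∈V∖N[v] {a} a≢v ¬va =
      subst T (sym (lookup∘tabulate _ a)) (T-∧ .from (≢⇒not==F a≢v , ¬T⇒T-not ¬va))

    v∉V∖N[v] : ¬ T (v ∈? V∖N[v])
    v∉V∖N[v] v∈ = T-not⇒¬T (proj₁ (V∖N[v]-spec v∈)) (≡⇒==F {a = v} refl)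

    neighbour∉V∖N[v] : ∀ {a} → T (E v a) → ¬ T (a ∈? V∖N[v])
    neighbour∉V∖N[v] va a∈ = T-not⇒¬T (proj₂ (V∖N[v]-spec a∈)) va

    E/v-clique : ∀ {a c} → a ≢ c → T (E v a) → T (E v c) → T (E/v a c)
    E/v-clique {a} {c} a≢c va vc =
      T-∨ {E a c} .from (inj₂ (T-∧ .from (≢⇒not==F a≢c , T-∧ .from (va , vc))))

    E/v-edge⁻ : ∀ {a c} → T (E/v a c) → T (E a c) ⊎ (T (E v a) × T (E v c))
    E/v-edge⁻ {a} {c} e with T-∨ {E a c} .to e
    ... | inj₁ ac    = inj₁ ac
    ... | inj₂ via-v = inj₂ (T-∧ .to (proj₂ (T-∧ {not (a ==F c)} .to via-v)))

    E-edge⇒E/v-walk : ∀ {X} → InducedEdge E X ⇒ Walk E/v X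
    E-edge⇒E/v-walk (a∈X , c∈X , ac) = (a∈X , c∈X , T-∨ .from (inj₁ ac)) ◅ ε

  module Insertion (X : VSet n) (v∉X : lookup X v ≡ false) where

    X∪v : VSet n
    X∪v = X [ v ]≔ true

    v∈X∪v : T (v ∈? X∪v)
    v∈X∪v = subst T (sym (lookup∘update v X true)) tt

    ∈X∪v⁺ : ∀ {a} → T (a ∈? X) → T (a ∈? X∪v)
    ∈X∪v⁺ {a} a∈X with a ≟ v
    ... | yes refl = v∈X∪v
    ... | no  a≢v  = subst T (sym (lookup∘update′ a≢v X true)) a∈X

    ∈X∪v⁻ : ∀ {a} → T (a ∈? X∪v) → a ≡ v ⊎ T (a ∈? X)
    ∈X∪v⁻ {a} a∈X∪v with a ≟ v
    ... | yes a≡v = inj₁ a≡v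
    ... | no  a≢v = inj₂ (subst T (lookup∘update′ a≢v X true) a∈X∪v)

    ∈X⇒≢v : ∀ {a} → T (a ∈? X) → a ≢ v
    ∈X⇒≢v a∈X refl = subst T v∉X a∈X

    E/v-edge⇒walk : InducedEdge E/v X ⇒ Walk E X∪v
    E/v-edge⇒walk (a∈X , c∈X , e) with E/v-edge⁻ e
    ... | inj₁ ac        = (∈X∪v⁺ a∈X , ∈X∪v⁺ c∈X , ac) ◅ ε
    ... | inj₂ (va , vc) = (∈X∪v⁺ a∈X , v∈X∪v , adj-sym va) ◅ (v∈X∪v , ∈X∪v⁺ c∈X , vc) ◅ ε

    -- A visit of v between a and d becomes the edge a d of G/v, or vanishes if a = d.
    shortcut : ∀ {a b} → T (a ∈? X) → T (b ∈? X) → Walk E X∪v a b → Walk E/v X a b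
    bypass   : ∀ {a b} → T (a ∈? X) → T (b ∈? X) → T (E a v) → Walk E X∪v v b →
               Walk E/v X a b

    shortcut a∈X b∈X ε = ε
    shortcut a∈X b∈X ((_ , c∈X∪v , ac) ◅ w) with ∈X∪v⁻ c∈X∪v
    ... | inj₁ refl = bypass a∈X b∈X ac w
    ... | inj₂ c∈X  = (a∈X , c∈X , T-∨ .from (inj₁ ac)) ◅ shortcut c∈X b∈X w

    bypass a∈X b∈X av ε = ⊥-elim (∈X⇒≢v b∈X refl)
    bypass {a} a∈X b∈X av (_◅_ {j = d} (_ , d∈X∪v , vd) w) with ∈X∪v⁻ d∈X∪v
    ... | inj₁ refl = ⊥-elim (adj-irrefl vd)
    ... | inj₂ d∈X with a ≟ d
    ...   | yes refl = shortcut a∈X b∈X w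
    ...   | no  a≢d  = (a∈X , d∈X , E/v-clique a≢d (adj-sym av) vd) ◅ shortcut d∈X b∈X w

    edge-sym : Sym (InducedEdge E X∪v) (InducedEdge E X∪v)
    edge-sym (a∈X∪v , b∈X∪v , ab) = b∈X∪v , a∈X∪v , adj-sym ab

    Connected-insert⇒contr : ∀ {t} → T (t ∈? X) → Connected E X∪v → Connected E/v X
    member (Connected-insert⇒contr t∈X c) = _ , t∈X
    walk   (Connected-insert⇒contr t∈X c) a∈X b∈X =
      shortcut a∈X b∈X (walk c (∈X∪v⁺ a∈X) (∈X∪v⁺ b∈X))

    Connected-contr⇒insert : ∀ {t} → T (t ∈? X) → T (E v t) →
                             Connected E/v X → Connected E X∪v
    member (Connected-contr⇒insert t∈X vt c) = v , v∈X∪v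
    walk   (Connected-contr⇒insert {t} t∈X vt c) x∈ y∈ = to-t x∈ ◅◅ reverse edge-sym (to-t y∈)
      where
      to-t : ∀ {x} → T (x ∈? X∪v) → Walk E X∪v x t
      to-t x∈X∪v with ∈X∪v⁻ x∈X∪v
      ... | inj₁ refl = (v∈X∪v , ∈X∪v⁺ t∈X , vt) ◅ ε
      ... | inj₂ x∈X  = (E/v-edge⇒walk ⋆) (walk c x∈X t∈X)

    Isolated : Set
    Isolated = ∀ {a} → T (a ∈? X) → ¬ T (E v a)

    no-neighbour⇒Isolated : ¬ (∃ λ a → T ((a ∈? X) ∧ E v a)) → Isolated
    no-neighbour⇒Isolated ∄neighbour {a} a∈X va = ∄neighbour (a , T-∧ .from (a∈X , va))

    ¬Connected-insert : ∀ {t} → T (t ∈? X) → Isolated → ¬ Connected E X∪v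
    ¬Connected-insert t∈X isolated c = escape t∈X (walk c v∈X∪v (∈X∪v⁺ t∈X))
      where
      escape : ∀ {b} → T (b ∈? X) → Walk E X∪v v b → ⊥
      escape b∈X ε = ∈X⇒≢v b∈X refl
      escape b∈X ((_ , c∈X∪v , vc) ◅ _) with ∈X∪v⁻ c∈X∪v
      ... | inj₁ refl = adj-irrefl vc
      ... | inj₂ c∈X  = isolated c∈X vc

    Connected-contr-isolated : Isolated → Connected E/v X → Connected E X
    Connected-contr-isolated isolated = Connected-transfer edge
      where
      edge : InducedEdge E/v X ⇒ Walk E X
      edge (a∈X , c∈X , e) with E/v-edge⁻ e
      ... | inj₁ ac       = (a∈X , c∈X , ac) ◅ ε
      ... | inj₂ (va , _) = ⊥-elim (isolated a∈X va)

    Connected-singleton : (∀ a → ¬ T (a ∈? X)) → Connected E X∪v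
    member (Connected-singleton empty) = v , v∈X∪v
    walk   (Connected-singleton empty) x∈ y∈ with ∈X∪v⁻ x∈ | ∈X∪v⁻ y∈
    ... | inj₁ refl | inj₁ refl = ε
    ... | inj₂ x∈X  | _         = ⊥-elim (empty _ x∈X)
    ... | _         | inj₂ y∈X  = ⊥-elim (empty _ y∈X)

    insertion-identity :
      𝟙 (isConnectedSet E X∪v) + 𝟙 ((X ⊆? V∖N[v]) ∧ isConnectedSet E X)
        ≡ 𝟙 (isConnectedSet E/v X) + 𝟙 (size X ≡ᵇ 0)
    insertion-identity with any? (λ a → T? (a ∈? X))
    ... | no ∄member =
      𝟙+𝟙-cong (isConnectedSet-true E X∪v (Connected-singleton empty))
               (trans (cong (X ⊆? V∖N[v] ∧_) (isConnectedSet-false E X (∄member ∘ member)))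
                      (∧-zeroʳ (X ⊆? V∖N[v])))
               (isConnectedSet-false E/v X (∄member ∘ member))
               (size-empty X empty)
               refl
      where
      empty : ∀ a → ¬ T (a ∈? X)
      empty a a∈X = ∄member (a , a∈X)
    ... | yes (t , t∈X) with any? (λ a → T? ((a ∈? X) ∧ E v a))
    ...   | yes (s , s∈X∧vs) =
      𝟙+𝟙-cong (isConnectedSet-≡ E X∪v E/v X (Connected-insert⇒contr s∈X)
                                             (Connected-contr⇒insert s∈X vs))
               (cong (_∧ isConnectedSet E X) (⊆?-false X V∖N[v] s∈X (neighbour∉V∖N[v] vs)))
               refl
               (size-member X t∈X)
               refl
      where
      s∈X : T (s ∈? X)
      s∈X = proj₁ (T-∧ .to s∈X∧vs)

      vs : T (E v s)
      vs = proj₂ (T-∧ {s ∈? X} .to s∈X∧vs)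
    ...   | no ∄neighbour =
      𝟙+𝟙-cong (isConnectedSet-false E X∪v (¬Connected-insert t∈X isolated))
               (cong₂ _∧_ (T-≡ .to (⊆?⁺ X V∖N[v] (λ a∈X → ∈V∖N[v] (∈X⇒≢v a∈X) (isolated a∈X))))
                          (isConnectedSet-≡ E X E/v X (Connected-transfer (E-edge⇒E/v-walk {X}))
                                                      (Connected-contr-isolated isolated)))
               refl
               (size-member X t∈X)
               (sym (+-identityʳ _))
      where
      isolated : Isolated
      isolated = no-neighbour⇒Isolated ∄neighbour

    counted-identity : ∀ k →
      𝟙 (isCounted E (fullSet n) (suc k) X) + 𝟙 (isCounted E (fullSet n) (suc k) X∪v)
        + 𝟙 (isCounted E V∖N[v] k X)
      ≡ 𝟙 (isCounted E V∖v (suc k) X) + 𝟙 (isCounted E/v V∖v k X) + 𝟙 ((size X ≡ᵇ 0) ∧ (size X ≡ᵇ k))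
    counted-identity k = begin
      𝟙 (isCounted E (fullSet n) (suc k) X) + 𝟙 (isCounted E (fullSet n) (suc k) X∪v)
        + 𝟙 (isCounted E V∖N[v] k X)
        ≡⟨ cong₂ _+_ (cong₂ _+_ (cong 𝟙 (isCounted-⊆ E (fullSet n) X (suc k) (⊆?-fullSet X)))
                                (cong 𝟙 X∪v-counted))
                     (cong 𝟙 (sym (∧-assoc (X ⊆? V∖N[v]) (isConnectedSet E X) s))) ⟩
      x + 𝟙 (isConnectedSet E X∪v ∧ s) + 𝟙 ((X ⊆? V∖N[v] ∧ isConnectedSet E X) ∧ s)
        ≡⟨ +-assoc x _ _ ⟩
      x + (𝟙 (isConnectedSet E X∪v ∧ s) + 𝟙 ((X ⊆? V∖N[v] ∧ isConnectedSet E X) ∧ s))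
        ≡⟨ cong (x +_) (𝟙-restrict (isConnectedSet E X∪v) (X ⊆? V∖N[v] ∧ isConnectedSet E X)
                                   (isConnectedSet E/v X) (size X ≡ᵇ 0) s insertion-identity) ⟩
      x + (𝟙 (isConnectedSet E/v X ∧ s) + 𝟙 ((size X ≡ᵇ 0) ∧ s))
        ≡⟨ +-assoc x _ _ ⟨
      x + 𝟙 (isConnectedSet E/v X ∧ s) + 𝟙 ((size X ≡ᵇ 0) ∧ s)
        ≡⟨ cong (_+ 𝟙 ((size X ≡ᵇ 0) ∧ s))
                (cong₂ _+_ (cong 𝟙 (isCounted-⊆ E V∖v X (suc k) X⊆V∖v))
                           (cong 𝟙 (isCounted-⊆ E/v V∖v X k X⊆V∖v))) ⟨
      𝟙 (isCounted E V∖v (suc k) X) + 𝟙 (isCounted E/v V∖v k X) + 𝟙 ((size X ≡ᵇ 0) ∧ s) ∎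
      where
      open ≡-Reasoning

      s : Bool
      s = size X ≡ᵇ k

      x : ℕ
      x = 𝟙 (isConnectedSet E X ∧ (size X ≡ᵇ suc k))

      X∪v-counted : isCounted E (fullSet n) (suc k) X∪v ≡ isConnectedSet E X∪v ∧ s
      X∪v-counted = trans (isCounted-⊆ E (fullSet n) X∪v (suc k) (⊆?-fullSet X∪v))
                          (cong (λ m → isConnectedSet E X∪v ∧ (m ≡ᵇ suc k)) (size-insert X v v∉X))

      X⊆V∖v : T (X ⊆? V∖v)
      X⊆V∖v = ⊆?⁺ X V∖v (λ a∈X → ∈V∖v (∈X⇒≢v a∈X))

  recurrence-pointwise : ∀ k X →
    (if lookup X v then 0 else
       𝟙 (isCounted E (fullSet n) (suc k) X) + 𝟙 (isCounted E (fullSet n) (suc k) (X [ v ]≔ true)))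
      + 𝟙 (isCounted E V∖N[v] k X)
    ≡ 𝟙 (isCounted E V∖v (suc k) X) + 𝟙 (isCounted E/v V∖v k X) + 𝟙 ((size X ≡ᵇ 0) ∧ (size X ≡ᵇ k))
  recurrence-pointwise k X with lookup X v in X∋v
  ... | false = Insertion.counted-identity X X∋v k
  ... | true  =
    trans (cong 𝟙 (isCounted-⊈ E V∖N[v] X k v∈X v∉V∖N[v]))
          (sym (cong₂ _+_ (cong₂ _+_ (cong 𝟙 (isCounted-⊈ E V∖v X (suc k) v∈X v∉V∖v))
                                     (cong 𝟙 (isCounted-⊈ E/v V∖v X k v∈X v∉V∖v)))
                          (cong (λ b → 𝟙 (b ∧ (size X ≡ᵇ k))) (size-member X v∈X))))
    where
    v∈X : T (v ∈? X)
    v∈X = T-≡ .from X∋v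

  connectedSet-recurrence : ∀ k →
    CScoeff (whole G) (suc k) + CScoeff (delN G v) k
      ≡ CScoeff (del G v) (suc k) + CScoeff (contr G v) k + 𝟙 (0 ≡ᵇ k)
  connectedSet-recurrence k = begin
    Sk E (fullSet n) (suc k) + Sk E V∖N[v] k
      ≡⟨ cong₂ _+_ (trans (Sk-as-sumSubsets E (fullSet n) (suc k)) (sumSubsets-split v Whole))
                   (Sk-as-sumSubsets E V∖N[v] k) ⟩
    sumSubsets Split + sumSubsets DelN
      ≡⟨ sumSubsets-+ Split DelN ⟨
    sumSubsets (λ X → Split X + DelN X)
      ≡⟨ sumSubsets-cong (recurrence-pointwise k) ⟩
    sumSubsets (λ X → Del X + Contr X + Empty X)
      ≡⟨ trans (sumSubsets-+ (λ X → Del X + Contr X) Empty)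
               (cong (_+ sumSubsets Empty) (sumSubsets-+ Del Contr)) ⟩
    sumSubsets Del + sumSubsets Contr + sumSubsets Empty
      ≡⟨ cong₂ _+_ (cong₂ _+_ (sym (Sk-as-sumSubsets E V∖v (suc k)))
                              (sym (Sk-as-sumSubsets E/v V∖v k)))
                   (sumSubsets-empty n k) ⟩
    Sk E V∖v (suc k) + Sk E/v V∖v k + 𝟙 (0 ≡ᵇ k) ∎
    where
    open ≡-Reasoning
    Whole Split DelN Del Contr Empty : VSet n → ℕ
    Whole X = 𝟙 (isCounted E (fullSet n) (suc k) X)
    Split X = if lookup X v then 0 else Whole X + Whole (X [ v ]≔ true)
    DelN  X = 𝟙 (isCounted E V∖N[v] k X)
    Del   X = 𝟙 (isCounted E V∖v (suc k) X)
    Contr X = 𝟙 (isCounted E/v V∖v k X)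
    Empty X = 𝟙 ((size X ≡ᵇ 0) ∧ (size X ≡ᵇ k))

lemma2p5 : {n m : ℕ} (G : Graph n) (H : Graph m) (v : Fin n) (u : Fin m) →
           del G v ⪯ del H u →
           contr G v ⪯ contr H u →
           delN H u ⪯ delN G v →
           whole G ⪯ whole H
lemma2p5 {n} G H v u _ _ _ zero = subst (_≤ _) (sym (Sk-zero (adj G) (fullSet n))) z≤n
lemma2p5 G H v u del⪯ contr⪯ delN⪯ (suc k) = +-cancelʳ-≤ (CScoeff (delN G v) k) _ _ (begin
  CScoeff (whole G) (suc k) + CScoeff (delN G v) k
    ≡⟨ connectedSet-recurrence G v k ⟩
  CScoeff (del G v) (suc k) + CScoeff (contr G v) k + 𝟙 (0 ≡ᵇ k)
    ≤⟨ +-monoˡ-≤ _ (+-mono-≤ (del⪯ (suc k)) (contr⪯ k)) ⟩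
  CScoeff (del H u) (suc k) + CScoeff (contr H u) k + 𝟙 (0 ≡ᵇ k)
    ≡⟨ connectedSet-recurrence H u k ⟨
  CScoeff (whole H) (suc k) + CScoeff (delN H u) k
    ≤⟨ +-monoʳ-≤ _ (delN⪯ k) ⟩
  CScoeff (whole H) (suc k) + CScoeff (delN G v) k ∎)
  where open ≤-Reasoning
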